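{- Let $p\in\mathbb{N}$ and let $\phi$ be any one of the following first-order sentences in the language $\{R_1,R_2,R_3\}$ ($R_i(x,y)$ meaning $d(x,y)=i$): (1) any two distinct points are at distance $1$, $2$ or $3$; (2) no point is at distance $3$ from two distinct points; (3) for any three distinct points, either all three pairwise distances are $2$ or exactly one of them is $2$; (4) there exist points $u_1,\dots,u_p$ pairwise distinct and points $v_1,\dots,v_p$ pairwise distinct with $d(u_i,v_i)=3$ for all $i$; (5) there exist pairwise distinct points $u_1,\dots,u_p$ such that for every $i$ and every point $v\ne u_i$, if $d(u_i,v)\ne 2$ then $d(u_i,v)=1$. Let $\mathfrak{m}(n)$ be the proportion, among all metric spaces in $\mathcal{A}^3_{\infty,0,7,8}$ with universe $\{1,\dots,n\}$ (not counted up to isomorphism), of those satisfying $\phi$. Then $\lim_{n\to\infty}\mathfrak{m}(n)=1$.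
   Context: $\mathcal{A}^3_{\infty,0,7,8}$ is the class of finite metric spaces, all of whose distances between distinct points lie in $\{1,2,3\}$, in which for every three distinct points the multiset of their pairwise distances is one of $\{1,1,2\}$, $\{1,2,3\}$, $\{2,2,2\}$. -}

module Defs where

open import Data.Nat using (ℕ; zero; suc; _+_; _*_; _∸_; _≤_; _≤?_)
open import Data.Nat.Properties using (_≟_)
open import Data.Fin using (Fin; toℕ)
import Data.Fin as F
open import Data.Fin.Properties using (any?; all?)
open import Data.Vec using (Vec; []; _∷_; lookup)
open import Data.List using (List; []; _∷_; [_]; map; concatMap; filter; length; allFin)
open import Data.Product using (Σ; ∃; _×_; _,_)
open import Data.Product.Properties using (≡-dec)
open import Data.Sum using (_⊎_)
open import Relation.Binary.PropositionalEquality using (_≡_; _≢_)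
open import Relation.Nullary using (¬_; Dec; yes; no)
open import Relation.Nullary.Decidable using (map′; ¬?; _×-dec_; _⊎-dec_; _→-dec_)

-- Finite "metric structures" on the universe {1,…,n} (modelled by Fin n)
-- with all distances in {0,1,2,3}: a distance matrix with entries in Fin 4.
-- Every metric space on {1..n} whose distances lie in {1,2,3} (the only
-- ones relevant for the class A^3_{∞,0,7,8}) is exactly one such matrix.

Mat : ℕ → Set
Mat n = Fin n → Fin n → Fin 4

d : ∀ {n} → Mat n → Fin n → Fin n → ℕ
d M x y = toℕ (M x y)

IsMetric : ∀ {n} → Mat n → Set
IsMetric {n} M =
  (∀ x → d M x x ≡ 0) ×
  (∀ x y → x ≢ y → ¬ (d M x y ≡ 0)) ×
  (∀ x y → d M x y ≡ d M y x) ×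
  (∀ x y z → d M x z ≤ d M x y + d M y z)

Dist123 : ∀ {n} → Mat n → Set
Dist123 {n} M = ∀ x y → x ≢ y → (d M x y ≡ 1) ⊎ (d M x y ≡ 2) ⊎ (d M x y ≡ 3)

Triple : Set
Triple = ℕ × ℕ × ℕ

SameMultiset : Triple → Triple → Set
SameMultiset (a , b , c) t =
  ((a , b , c) ≡ t) ⊎ ((a , c , b) ≡ t) ⊎ ((b , a , c) ≡ t) ⊎
  ((b , c , a) ≡ t) ⊎ ((c , a , b) ≡ t) ⊎ ((c , b , a) ≡ t)

AllowedTriangle : Triple → Set
AllowedTriangle t =
  SameMultiset t (1 , 1 , 2) ⊎ SameMultiset t (1 , 2 , 3) ⊎ SameMultiset t (2 , 2 , 2)

Distinct3 : ∀ {n} → Fin n → Fin n → Fin n → Set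
Distinct3 x y z = (x ≢ y) × (x ≢ z) × (y ≢ z)

InClass : ∀ {n} → Mat n → Set
InClass {n} M = IsMetric M × Dist123 M ×
  (∀ x y z → Distinct3 x y z → AllowedTriangle (d M x y , d M x z , d M y z))

data Sentence (p : ℕ) : Set where
  φ1 φ2 φ3 φ4 φ5 : Sentence p

Distinct : ∀ {n p} → Vec (Fin n) p → Set
Distinct {n} {p} u = ∀ (i j : Fin p) → i ≢ j → lookup u i ≢ lookup u j

ExactlyOneIs2 : ℕ → ℕ → ℕ → Set
ExactlyOneIs2 a b c =
  (a ≡ 2 × ¬ (b ≡ 2) × ¬ (c ≡ 2)) ⊎
  (¬ (a ≡ 2) × b ≡ 2 × ¬ (c ≡ 2)) ⊎
  (¬ (a ≡ 2) × ¬ (b ≡ 2) × c ≡ 2)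

Sat : ∀ {p n} → Sentence p → Mat n → Set
Sat φ1 M = Dist123 M
Sat φ2 M = ∀ x y z → y ≢ z → ¬ (d M x y ≡ 3 × d M x z ≡ 3)
Sat φ3 M = ∀ x y z → Distinct3 x y z →
  (d M x y ≡ 2 × d M x z ≡ 2 × d M y z ≡ 2) ⊎
  ExactlyOneIs2 (d M x y) (d M x z) (d M y z)
Sat {p} φ4 M = Σ (Vec _ p) λ u → Σ (Vec _ p) λ v →
  Distinct u × Distinct v × (∀ i → d M (lookup u i) (lookup v i) ≡ 3)
Sat {p} φ5 M = Σ (Vec _ p) λ u → Distinct u ×
  (∀ i v → v ≢ lookup u i → ¬ (d M (lookup u i) v ≡ 2) → d M (lookup u i) v ≡ 1)

∃Vec? : ∀ {n} p {P : Vec (Fin n) p → Set} → (∀ v → Dec (P v)) → Dec (∃ P)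
∃Vec? zero P? = map′ (λ h → [] , h) (λ { ([] , h) → h }) (P? [])
∃Vec? (suc p) {P} P? =
  map′ (λ { (x , xs , h) → x ∷ xs , h }) (λ { (x ∷ xs , h) → x , xs , h })
       (any? (λ x → ∃Vec? p (λ xs → P? (x ∷ xs))))

private
  _≟F_ : ∀ {n} (x y : Fin n) → Dec (x ≡ y)
  _≟F_ = Data.Fin._≟_

  _≟T_ : (s t : Triple) → Dec (s ≡ t)
  _≟T_ = ≡-dec _≟_ (≡-dec _≟_ _≟_)

  ≢? : ∀ {n} (x y : Fin n) → Dec (x ≢ y)
  ≢? x y = ¬? (x ≟F y)

  d3? : ∀ {n} (x y z : Fin n) → Dec (Distinct3 x y z)
  d3? x y z = ≢? x y ×-dec ≢? x z ×-dec ≢? y z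

  is? : (a k : ℕ) → Dec (a ≡ k)
  is? = _≟_

sameMultiset? : ∀ s t → Dec (SameMultiset s t)
sameMultiset? (a , b , c) t =
  ((a , b , c) ≟T t) ⊎-dec ((a , c , b) ≟T t) ⊎-dec ((b , a , c) ≟T t) ⊎-dec
  ((b , c , a) ≟T t) ⊎-dec ((c , a , b) ≟T t) ⊎-dec ((c , b , a) ≟T t)

allowed? : ∀ t → Dec (AllowedTriangle t)
allowed? t = sameMultiset? t _ ⊎-dec sameMultiset? t _ ⊎-dec sameMultiset? t _

dist123? : ∀ {n} (M : Mat n) → Dec (Dist123 M)
dist123? M = all? λ x → all? λ y →
  ≢? x y →-dec (is? _ 1 ⊎-dec is? _ 2 ⊎-dec is? _ 3)

distinct? : ∀ {n p} (u : Vec (Fin n) p) → Dec (Distinct u)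
distinct? u = all? λ i → all? λ j → ¬? (i ≟F j) →-dec ≢? (lookup u i) (lookup u j)

inClass? : ∀ {n} (M : Mat n) → Dec (InClass M)
inClass? M =
  ((all? λ x → is? _ 0) ×-dec
   (all? λ x → all? λ y → ≢? x y →-dec ¬? (is? _ 0)) ×-dec
   (all? λ x → all? λ y → d M x y ≟ d M y x) ×-dec
   (all? λ x → all? λ y → all? λ z → d M x z ≤? d M x y + d M y z))
  ×-dec dist123? M ×-dec
  (all? λ x → all? λ y → all? λ z → d3? x y z →-dec allowed? _)

sat? : ∀ {p n} (φ : Sentence p) (M : Mat n) → Dec (Sat φ M)
sat? φ1 M = dist123? M
sat? φ2 M = all? λ x → all? λ y → all? λ z →
  ≢? y z →-dec ¬? (is? _ 3 ×-dec is? _ 3)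
sat? φ3 M = all? λ x → all? λ y → all? λ z → d3? x y z →-dec
  ((is? _ 2 ×-dec is? _ 2 ×-dec is? _ 2) ⊎-dec
   ((is? _ 2 ×-dec ¬? (is? _ 2) ×-dec ¬? (is? _ 2)) ⊎-dec
    (¬? (is? _ 2) ×-dec is? _ 2 ×-dec ¬? (is? _ 2)) ⊎-dec
    (¬? (is? _ 2) ×-dec ¬? (is? _ 2) ×-dec is? _ 2)))
sat? {p} φ4 M = ∃Vec? p λ u → ∃Vec? p λ v →
  distinct? u ×-dec distinct? v ×-dec (all? λ i → is? _ 3)
sat? {p} φ5 M = ∃Vec? p λ u → distinct? u ×-dec
  (all? λ i → all? λ v → ≢? v (lookup u i) →-dec ¬? (is? _ 2) →-dec is? _ 1)

consF : ∀ {A : Set} {n} → A → (Fin n → A) → Fin (suc n) → A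
consF a f Fin.zero = a
consF a f (Fin.suc i) = f i

allFuns : ∀ {A : Set} → List A → (n : ℕ) → List (Fin n → A)
allFuns xs zero = [ (λ ()) ]
allFuns xs (suc n) =
  concatMap (λ a → map (λ f → consF a f) (allFuns xs n)) xs

allMats : (n : ℕ) → List (Mat n)
allMats n = allFuns (allFuns (allFin 4) n) n

total : ℕ → ℕ
total n = length (filter inClass? (allMats n))

good : ∀ {p} → Sentence p → ℕ → ℕ
good φ n = length (filter (λ M → inClass? M ×-dec sat? φ M) (allMats n))

module Submission where

-- Every allowed triangle has even perimeter and at most one side of length 3.  Hence a member
-- of the class is a bipartition of the points into two cliques at internal distance 2, with
-- distances 1 and 3 across, where the pairs at distance 3 form a matching; conversely every
-- such structure belongs to the class.  So sentences (1)-(3) hold in every member.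
--
-- The other two are handled by double counting.  If (5) fails, more than n - p points are
-- matched; removing the pair of a matched point x (its 3 becomes 1) leaves a member with at
-- most p + 1 unmatched points, from which the original is recovered given x and its old
-- partner, both now unmatched.  So the failures are at most (p + 1)² / (n - p) times as many
-- as all members.  If (4) fails, more than n - p points are unmatched; joining two of them,
-- x and y, at distance 3 (y moves to the side opposite x) gives a member recovered from the
-- pair and one bit, and a member has at most n pairs at distance 3.  So the failures are at
-- most about 2n / (n - p)² times as many as all members.

open import Data.Bool using (Bool; true; false; if_then_else_; not; _xor_)
import Data.Bool.Properties as Bool
open import Data.Fin using (Fin; zero; suc; toℕ; _≟_)
open import Data.Fin.Patterns using (0F; 1F; 2F; 3F)
open import Data.Fin.Properties using (suc-injective; any?; all?; toℕ-injective)
open import Data.List using (List; []; _∷_; _++_; map; concatMap; filter; length; tabulate; allFin; cartesianProduct)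
open import Data.List.Membership.Propositional using (_∈_)
open import Data.List.Membership.Propositional.Properties using (∈-tabulate⁺)
open import Data.List.Relation.Unary.Any using (here; there)
open import Data.Nat as ℕ using (ℕ; zero; suc; _+_; _*_; _∸_; _≤_; _<_; _≥_; _≤?_; z≤n; s≤s; NonZero)
open import Data.Nat.Properties
  using ( +-commutativeSemigroup; +-assoc; +-comm; +-identityʳ; *-assoc; *-comm; *-identityʳ; *-zeroʳ
        ; *-distribˡ-+; ≤-refl; ≤-reflexive; ≤-trans; ≤-antisym; ≤-pred; <⇒≤; ≰⇒>; m≤m+n; m≤n+m
        ; +-mono-≤; +-monoʳ-≤; +-monoˡ-<; +-cancelˡ-≤; +-cancelʳ-≤; +-cancelˡ-<
        ; *-mono-≤; *-monoʳ-≤; *-monoˡ-≤; *-cancelˡ-≤; m+n∸m≡n; module ≤-Reasoning )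
open import Data.Nat.Tactic.RingSolver using (solve-∀)
open import Algebra.Properties.CommutativeSemigroup +-commutativeSemigroup using (interchange)
open import Data.Product using (Σ-syntax; ∃; ∃-syntax; _×_; _,_; proj₁; proj₂)
open import Data.Sum using (_⊎_; inj₁; inj₂)
open import Data.Vec using (Vec; []; _∷_; lookup)
import Data.Vec as Vec
open import Data.Vec.Properties using (lookup-map; lookup∘tabulate)
open import Data.Vec.Functional using (updateAt)
open import Data.Vec.Functional.Properties using (updateAt-updates; updateAt-minimal)
open import Data.Vec.Functional.Relation.Binary.Pointwise using (Pointwise)
import Data.Vec.Functional.Relation.Binary.Pointwise.Properties as Pointwise
open import Defs
open import Function using (_∘_; id; const; flip)
open import Relation.Binary using (Decidable; IsEquivalence)
open import Relation.Binary.PropositionalEquality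
open import Relation.Nullary using (Dec; yes; no; does; ¬_; contradiction)
open import Relation.Nullary.Decidable using (dec-true; dec-false; _×-dec_; _⊎-dec_; _→-dec_; ¬?; from-yes)
import Relation.Unary as U

private variable
  A B : Set
  P Q R : Set
  n : ℕ

𝟙 : Dec P → ℕ
𝟙 P? = if does P? then 1 else 0

∑ : List A → (A → ℕ) → ℕ
∑ [] f = 0
∑ (x ∷ xs) f = f x + ∑ xs f

syntax ∑ xs (λ x → e) = ∑[ x ∈ xs ] e

𝟙-yes : (P? : Dec P) → P → 𝟙 P? ≡ 1
𝟙-yes P? p rewrite dec-true P? p = refl

𝟙-no : (P? : Dec P) → ¬ P → 𝟙 P? ≡ 0
𝟙-no P? ¬p rewrite dec-false P? ¬p = refl

𝟙-mono : (P? : Dec P) (Q? : Dec Q) → (P → Q) → 𝟙 P? ≤ 𝟙 Q?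
𝟙-mono (yes p) Q? P⇒Q = ≤-reflexive (sym (𝟙-yes Q? (P⇒Q p)))
𝟙-mono (no _) Q? P⇒Q = z≤n

𝟙-cong : (P? : Dec P) (Q? : Dec Q) → (P → Q) → (Q → P) → 𝟙 P? ≡ 𝟙 Q?
𝟙-cong P? Q? P⇒Q Q⇒P = ≤-antisym (𝟙-mono P? Q? P⇒Q) (𝟙-mono Q? P? Q⇒P)

𝟙-× : (P? : Dec P) (Q? : Dec Q) → 𝟙 (P? ×-dec Q?) ≡ 𝟙 P? * 𝟙 Q?
𝟙-× (yes _) Q? = sym (+-identityʳ (𝟙 Q?))
𝟙-× (no _) Q? = refl

𝟙-⊎ : (P? : Dec P) (Q? : Dec Q) (R? : Dec R) → (P → Q ⊎ R) → 𝟙 P? ≤ 𝟙 Q? + 𝟙 R?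
𝟙-⊎ (no _) Q? R? _ = z≤n
𝟙-⊎ (yes p) Q? R? P⇒Q⊎R with P⇒Q⊎R p
... | inj₁ q = ≤-trans (𝟙-mono (yes p) Q? (λ _ → q)) (m≤m+n (𝟙 Q?) (𝟙 R?))
... | inj₂ r = ≤-trans (𝟙-mono (yes p) R? (λ _ → r)) (m≤n+m (𝟙 R?) (𝟙 Q?))

𝟙-split : (P? : Dec P) (Q? : Dec Q) → 𝟙 P? ≡ 𝟙 (P? ×-dec Q?) + 𝟙 (P? ×-dec ¬? Q?)
𝟙-split (yes _) (yes _) = refl
𝟙-split (yes _) (no _) = refl
𝟙-split (no _) Q? = refl

𝟙-excluded-middle : (P? : Dec P) → 𝟙 P? + 𝟙 (¬? P?) ≡ 1
𝟙-excluded-middle (yes _) = refl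
𝟙-excluded-middle (no _) = refl

𝟙-guarded-≤ : ∀ {m c} (P? : Dec P) → (P → m ≤ c) → 𝟙 P? * m ≤ c * 𝟙 P?
𝟙-guarded-≤ {m = m} {c} (yes p) m≤c = begin
  m + 0  ≡⟨ +-identityʳ m ⟩
  m      ≤⟨ m≤c p ⟩
  c      ≡⟨ *-identityʳ c ⟨
  c * 1  ∎
  where open ≤-Reasoning
𝟙-guarded-≤ (no _) _ = z≤n

module _ {f g : A → ℕ} where

  ∑-cong : ∀ xs → (∀ x → f x ≡ g x) → ∑ xs f ≡ ∑ xs g
  ∑-cong [] f≗g = refl
  ∑-cong (x ∷ xs) f≗g = cong₂ _+_ (f≗g x) (∑-cong xs f≗g)

  ∑-mono-≤ : ∀ xs → (∀ x → f x ≤ g x) → ∑ xs f ≤ ∑ xs g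
  ∑-mono-≤ [] f≤g = z≤n
  ∑-mono-≤ (x ∷ xs) f≤g = +-mono-≤ (f≤g x) (∑-mono-≤ xs f≤g)

  ∑-distrib-+ : ∀ xs → ∑[ x ∈ xs ] (f x + g x) ≡ ∑ xs f + ∑ xs g
  ∑-distrib-+ [] = refl
  ∑-distrib-+ (x ∷ xs) =
    trans (cong (f x + g x +_) (∑-distrib-+ xs)) (interchange (f x) (g x) (∑ xs f) (∑ xs g))

∑-zero : ∀ (xs : List A) → ∑[ x ∈ xs ] 0 ≡ 0
∑-zero [] = refl
∑-zero (x ∷ xs) = ∑-zero xs

∑-*ˡ : ∀ c (xs : List A) (f : A → ℕ) → ∑[ x ∈ xs ] (c * f x) ≡ c * ∑ xs f
∑-*ˡ c [] f = sym (*-zeroʳ c)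
∑-*ˡ c (x ∷ xs) f = trans (cong (c * f x +_) (∑-*ˡ c xs f)) (sym (*-distribˡ-+ c (f x) (∑ xs f)))

∑-*ʳ : ∀ c (xs : List A) (f : A → ℕ) → ∑[ x ∈ xs ] (f x * c) ≡ ∑ xs f * c
∑-*ʳ c xs f = trans (∑-cong xs (λ x → *-comm (f x) c)) (trans (∑-*ˡ c xs f) (*-comm c (∑ xs f)))

∑∑-*ˡ : ∀ c (xs : List A) (ys : List B) (f : A → B → ℕ) →
  ∑[ x ∈ xs ] ∑[ y ∈ ys ] (c * f x y) ≡ c * ∑[ x ∈ xs ] ∑[ y ∈ ys ] f x y
∑∑-*ˡ c xs ys f = trans (∑-cong xs (λ x → ∑-*ˡ c ys (f x))) (∑-*ˡ c xs (λ x → ∑[ y ∈ ys ] f x y))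

∑-++ : ∀ (xs ys : List A) f → ∑ (xs ++ ys) f ≡ ∑ xs f + ∑ ys f
∑-++ [] ys f = refl
∑-++ (x ∷ xs) ys f = trans (cong (f x +_) (∑-++ xs ys f)) (sym (+-assoc (f x) _ _))

∑-map : ∀ (g : A → B) xs f → ∑ (map g xs) f ≡ ∑[ x ∈ xs ] f (g x)
∑-map g [] f = refl
∑-map g (x ∷ xs) f = cong (f (g x) +_) (∑-map g xs f)

∑-concatMap : ∀ (g : A → List B) xs f → ∑ (concatMap g xs) f ≡ ∑[ x ∈ xs ] ∑ (g x) f
∑-concatMap g [] f = refl
∑-concatMap g (x ∷ xs) f = trans (∑-++ (g x) _ f) (cong (∑ (g x) f +_) (∑-concatMap g xs f))

∑-swap : ∀ (xs : List A) (ys : List B) (f : A → B → ℕ) →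
  ∑[ x ∈ xs ] ∑[ y ∈ ys ] f x y ≡ ∑[ y ∈ ys ] ∑[ x ∈ xs ] f x y
∑-swap [] ys f = sym (∑-zero ys)
∑-swap (x ∷ xs) ys f = trans (cong (∑ ys (f x) +_) (∑-swap xs ys f)) (sym (∑-distrib-+ ys))

∑-cartesianProduct : ∀ (xs : List A) (ys : List B) f →
  ∑ (cartesianProduct xs ys) f ≡ ∑[ x ∈ xs ] ∑[ y ∈ ys ] f (x , y)
∑-cartesianProduct [] ys f = refl
∑-cartesianProduct (x ∷ xs) ys f =
  trans (∑-++ (map (x ,_) ys) _ f) (cong₂ _+_ (∑-map (x ,_) ys f) (∑-cartesianProduct xs ys f))

∑-≥-∈ : ∀ {x} {xs : List A} f → x ∈ xs → f x ≤ ∑ xs f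
∑-≥-∈ {xs = y ∷ ys} f (here refl) = m≤m+n (f y) (∑ ys f)
∑-≥-∈ {xs = y ∷ ys} f (there x∈ys) = ≤-trans (∑-≥-∈ f x∈ys) (m≤n+m (∑ ys f) (f y))

length-filter : ∀ {P : A → Set} (P? : U.Decidable P) xs → length (filter P? xs) ≡ ∑[ x ∈ xs ] 𝟙 (P? x)
length-filter P? [] = refl
length-filter P? (x ∷ xs) with does (P? x)
... | true = cong suc (length-filter P? xs)
... | false = length-filter P? xs

∑-tabulate : ∀ (g : Fin n → A) f → ∑ (tabulate g) f ≡ ∑[ i ∈ allFin n ] f (g i)
∑-tabulate {zero} g f = refl
∑-tabulate {suc n} g f =
  cong (f (g zero) +_) (trans (∑-tabulate (g ∘ suc) f) (sym (∑-tabulate suc (f ∘ g))))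

∑-allFin-suc : ∀ n f → ∑[ i ∈ allFin (suc n) ] f i ≡ f zero + ∑[ i ∈ allFin n ] f (suc i)
∑-allFin-suc n f = cong (f zero +_) (∑-tabulate suc f)

∑-allFin-1 : ∀ n → ∑[ i ∈ allFin n ] 1 ≡ n
∑-allFin-1 zero = refl
∑-allFin-1 (suc n) = trans (∑-allFin-suc n (λ _ → 1)) (cong suc (∑-allFin-1 n))

∑-allFin-once : ∀ (j : Fin n) → ∑[ i ∈ allFin n ] 𝟙 (i ≟ j) ≡ 1
∑-allFin-once {suc n} zero = trans (∑-allFin-suc n (λ i → 𝟙 (i ≟ zero))) (cong suc (∑-zero (allFin n)))
∑-allFin-once {suc n} (suc j) = trans (∑-allFin-suc n (λ i → 𝟙 (i ≟ suc j))) (∑-allFin-once j)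

∑-allFin-≤1 : ∀ {P : Fin n → Set} (P? : U.Decidable P) → (∀ {i j} → P i → P j → i ≡ j) →
  ∑[ i ∈ allFin n ] 𝟙 (P? i) ≤ 1
∑-allFin-≤1 {n} P? unique with any? P?
... | yes (j , Pj) = begin
  ∑[ i ∈ allFin n ] 𝟙 (P? i)   ≤⟨ ∑-mono-≤ (allFin n) (λ i → 𝟙-mono (P? i) (i ≟ j) (flip unique Pj)) ⟩
  ∑[ i ∈ allFin n ] 𝟙 (i ≟ j)  ≡⟨ ∑-allFin-once j ⟩
  1                             ∎
  where open ≤-Reasoning
... | no ∄ = ≤-trans (≤-reflexive none) z≤n
  where
  none : ∑[ i ∈ allFin n ] 𝟙 (P? i) ≡ 0
  none = trans (∑-cong (allFin n) (λ i → 𝟙-no (P? i) (λ Pi → ∄ (i , Pi)))) (∑-zero (allFin n))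

module _ {P : Fin n → Set} (P? : U.Decidable P) where

  private
    u = ∑[ i ∈ allFin n ] 𝟙 (P? i)

  ∑-square : ∑[ i ∈ allFin n ] ∑[ j ∈ allFin n ] 𝟙 (P? i ×-dec P? j) ≡ u * u
  ∑-square = begin
    ∑[ i ∈ allFin n ] ∑[ j ∈ allFin n ] 𝟙 (P? i ×-dec P? j)
      ≡⟨ ∑-cong (allFin n) (λ i → ∑-cong (allFin n) (λ j → 𝟙-× (P? i) (P? j))) ⟩
    ∑[ i ∈ allFin n ] ∑[ j ∈ allFin n ] (𝟙 (P? i) * 𝟙 (P? j))
      ≡⟨ ∑-cong (allFin n) (λ i → ∑-*ˡ (𝟙 (P? i)) (allFin n) (𝟙 ∘ P?)) ⟩
    ∑[ i ∈ allFin n ] (𝟙 (P? i) * u)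
      ≡⟨ ∑-*ʳ u (allFin n) (𝟙 ∘ P?) ⟩
    u * u ∎
    where open ≡-Reasoning

  ∑-distinct-pairs : u * u ≤ ∑[ i ∈ allFin n ] ∑[ j ∈ allFin n ] 𝟙 (P? i ×-dec P? j ×-dec ¬? (i ≟ j)) + u
  ∑-distinct-pairs = begin
    u * u
      ≡⟨ ∑-square ⟨
    ∑[ i ∈ allFin n ] ∑[ j ∈ allFin n ] 𝟙 (P? i ×-dec P? j)
      ≤⟨ ∑-mono-≤ (allFin n) (λ i → ∑-mono-≤ (allFin n) (split i)) ⟩
    ∑[ i ∈ allFin n ] ∑[ j ∈ allFin n ] (pair i j + 𝟙 (P? i) * 𝟙 (j ≟ i))
      ≡⟨ ∑-cong (allFin n) (λ i → trans (∑-distrib-+ (allFin n))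
           (cong (∑[ j ∈ allFin n ] pair i j +_) (∑-*ˡ (𝟙 (P? i)) (allFin n) (λ j → 𝟙 (j ≟ i))))) ⟩
    ∑[ i ∈ allFin n ] (∑[ j ∈ allFin n ] pair i j + 𝟙 (P? i) * ∑[ j ∈ allFin n ] 𝟙 (j ≟ i))
      ≡⟨ ∑-cong (allFin n) (λ i →
           cong (λ c → ∑[ j ∈ allFin n ] pair i j + 𝟙 (P? i) * c) (∑-allFin-once i)) ⟩
    ∑[ i ∈ allFin n ] (∑[ j ∈ allFin n ] pair i j + 𝟙 (P? i) * 1)
      ≡⟨ trans (∑-distrib-+ (allFin n)) (cong (∑[ i ∈ allFin n ] ∑[ j ∈ allFin n ] pair i j +_)
           (∑-cong (allFin n) (*-identityʳ ∘ 𝟙 ∘ P?))) ⟩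
    ∑[ i ∈ allFin n ] ∑[ j ∈ allFin n ] pair i j + u ∎
    where
    open ≤-Reasoning
    pair = λ i j → 𝟙 (P? i ×-dec P? j ×-dec ¬? (i ≟ j))
    split : ∀ i j → 𝟙 (P? i ×-dec P? j) ≤ pair i j + 𝟙 (P? i) * 𝟙 (j ≟ i)
    split i j with P? i | P? j | i ≟ j
    ... | no _ | _ | _ = z≤n
    ... | yes _ | no _ | _ = z≤n
    ... | yes _ | yes _ | no _ = s≤s z≤n
    ... | yes _ | yes _ | yes refl = ≤-reflexive (sym (trans (+-identityʳ _) (𝟙-yes (i ≟ i) refl)))

module _ {_≈_ : A → A → Set} (_≈?_ : Decidable _≈_) where

  allFuns-once : ∀ {xs} → (∀ b → ∑[ a ∈ xs ] 𝟙 (a ≈? b) ≡ 1) →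
    ∀ n (g : Fin n → A) → ∑[ f ∈ allFuns xs n ] 𝟙 (Pointwise.decidable _≈?_ f g) ≡ 1
  allFuns-once once zero g = refl
  allFuns-once {xs} once (suc n) g = begin
    ∑[ f ∈ allFuns xs (suc n) ] 𝟙 (f ≈̇? g)
      ≡⟨ ∑-concatMap (λ a → map (consF a) (allFuns xs n)) xs (λ f → 𝟙 (f ≈̇? g)) ⟩
    ∑[ a ∈ xs ] ∑ (map (consF a) (allFuns xs n)) (λ f → 𝟙 (f ≈̇? g))
      ≡⟨ ∑-cong xs (λ a → ∑-map (consF a) (allFuns xs n) (λ f → 𝟙 (f ≈̇? g))) ⟩
    ∑[ a ∈ xs ] ∑[ f ∈ allFuns xs n ] 𝟙 ((a ≈? g zero) ×-dec (f ≈̇? (g ∘ suc)))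
      ≡⟨ ∑-cong xs (λ a → ∑-cong (allFuns xs n) λ f → 𝟙-× (a ≈? g zero) (f ≈̇? (g ∘ suc))) ⟩
    ∑[ a ∈ xs ] ∑[ f ∈ allFuns xs n ] (𝟙 (a ≈? g zero) * 𝟙 (f ≈̇? (g ∘ suc)))
      ≡⟨ ∑-cong xs (λ a → ∑-*ˡ (𝟙 (a ≈? g zero)) (allFuns xs n) (λ f → 𝟙 (f ≈̇? (g ∘ suc)))) ⟩
    ∑[ a ∈ xs ] (𝟙 (a ≈? g zero) * ∑[ f ∈ allFuns xs n ] 𝟙 (f ≈̇? (g ∘ suc)))
      ≡⟨ ∑-cong xs (λ a → cong (𝟙 (a ≈? g zero) *_) (allFuns-once once n (g ∘ suc))) ⟩
    ∑[ a ∈ xs ] (𝟙 (a ≈? g zero) * 1)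
      ≡⟨ ∑-cong xs (λ a → *-identityʳ _) ⟩
    ∑[ a ∈ xs ] 𝟙 (a ≈? g zero)
      ≡⟨ once (g zero) ⟩
    1 ∎
    where
    open ≡-Reasoning
    _≈̇?_ : ∀ {m} → Decidable (Pointwise _≈_ {m})
    _≈̇?_ = Pointwise.decidable _≈?_

_≋_ : Mat n → Mat n → Set
_≋_ = Pointwise (Pointwise _≡_)

_≋?_ : Decidable (_≋_ {n})
_≋?_ = Pointwise.decidable (Pointwise.decidable _≟_)

≋-isEquivalence : IsEquivalence (_≋_ {n})
≋-isEquivalence {n} = Pointwise.isEquivalence (Pointwise.isEquivalence isEquivalence n) n

module ≋ {n} = IsEquivalence (≋-isEquivalence {n})

allMats-once : ∀ (N : Mat n) → ∑[ M ∈ allMats n ] 𝟙 (M ≋? N) ≡ 1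
allMats-once {n} = allFuns-once (Pointwise.decidable _≟_) (allFuns-once _≟_ ∑-allFin-once n) n

Distinct-suc : ∀ {p} (u : Vec (Fin n) p) → Distinct u → Distinct (Vec.map suc u)
Distinct-suc u distinct i j i≢j eq =
  distinct i j i≢j (suc-injective (trans (sym (lookup-map i suc u)) (trans eq (lookup-map j suc u))))

Distinct-zero∷suc : ∀ {p} (u : Vec (Fin n) p) → Distinct u → Distinct (zero ∷ Vec.map suc u)
Distinct-zero∷suc u distinct zero zero 0≢0 _ = 0≢0 refl
Distinct-zero∷suc u distinct zero (suc j) _ eq with trans eq (lookup-map j suc u)
... | ()
Distinct-zero∷suc u distinct (suc i) zero _ eq with trans (sym eq) (lookup-map i suc u)
... | ()
Distinct-zero∷suc u distinct (suc i) (suc j) i≢j = Distinct-suc u distinct i j (i≢j ∘ cong suc)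

∀-map-suc : ∀ {P : Fin (suc n) → Set} {p} (u : Vec (Fin n) p) →
  (∀ i → P (suc (lookup u i))) → ∀ i → P (lookup (Vec.map suc u) i)
∀-map-suc {P = P} u Pu i = subst P (sym (lookup-map i suc u)) (Pu i)

distinct-witnesses : ∀ {P : Fin n → Set} (P? : U.Decidable P) p → p ≤ ∑[ i ∈ allFin n ] 𝟙 (P? i) →
  Σ[ u ∈ Vec (Fin n) p ] Distinct u × (∀ i → P (lookup u i))
distinct-witnesses P? zero _ = [] , (λ ()) , (λ ())
distinct-witnesses {zero} P? (suc p) ()
distinct-witnesses {suc n} {P} P? (suc p) p<∑ with P? zero | subst (suc p ≤_) (∑-allFin-suc n (𝟙 ∘ P?)) p<∑
... | yes P0 | s≤s p≤∑ =
  let u , distinct , Pu = distinct-witnesses (P? ∘ suc) p p≤∑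
  in zero ∷ Vec.map suc u , Distinct-zero∷suc u distinct , λ { zero → P0 ; (suc i) → ∀-map-suc {P = P} u Pu i }
... | no _ | p<∑′ =
  let u , distinct , Pu = distinct-witnesses (P? ∘ suc) (suc p) p<∑′
  in Vec.map suc u , Distinct-suc u distinct , ∀-map-suc {P = P} u Pu

-- A bad a with a move π is encoded by (apply π a, π, q); decodability makes this encoding
-- injective, so such pairs are at most as many as codes.
module DoubleCounting
  {A P Q : Set} {_≈_ : A → A → Set} (≈-equiv : IsEquivalence _≈_) (_≈?_ : Decidable _≈_)
  (L : List A) (L-once : ∀ b → ∑[ a ∈ L ] 𝟙 (a ≈? b) ≡ 1)
  {Bad : A → Set} (bad? : U.Decidable Bad)
  (Ps : List P) {Move : A → P → Set} (move? : ∀ a π → Dec (Move a π))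
  (Qs : List Q) {Code : A → P → Q → Set} (code? : ∀ a π q → Dec (Code a π q))
  (apply : P → A → A) (decode : P → Q → A → A)
  (code-resp : ∀ {a b π q} → a ≈ b → Code a π q → Code b π q)
  (decode-resp : ∀ {a b π q} → a ≈ b → decode π q a ≈ decode π q b)
  (decodable : ∀ {a π} → Bad a → Move a π →
    ∃[ q ] q ∈ Qs × Code (apply π a) π q × decode π q (apply π a) ≈ a)
  where

  open IsEquivalence ≈-equiv using () renaming (sym to ≈-sym; trans to ≈-trans)

  private
    moves : A → P → ℕ
    moves a π = 𝟙 (bad? a ×-dec move? a π)

    codes : A → P → Q → A → ℕ
    codes a′ π q a = 𝟙 (code? a′ π q) * 𝟙 (a ≈? decode π q a′)

    weighted-moves : ∀ m → (∀ {a} → Bad a → m ≤ ∑[ π ∈ Ps ] 𝟙 (move? a π)) →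
      ∀ a → m * 𝟙 (bad? a) ≤ ∑[ π ∈ Ps ] moves a π
    weighted-moves m m≤ a with bad? a
    ... | yes bad = ≤-trans (≤-reflexive (*-identityʳ m)) (m≤ bad)
    ... | no _ = ≤-reflexive (trans (*-zeroʳ m) (sym (∑-zero Ps)))

    move-encoded : ∀ a π a′ → moves a π * 𝟙 (a′ ≈? apply π a) ≤ ∑[ q ∈ Qs ] codes a′ π q a
    move-encoded a π a′ with bad? a | move? a π | a′ ≈? apply π a
    ... | no _ | _ | _ = z≤n
    ... | yes _ | no _ | _ = z≤n
    ... | yes _ | yes _ | no _ = z≤n
    ... | yes bad | yes move | yes a′≈ =
      let q , q∈Qs , code , decoded = decodable bad move
          code′ = code-resp (≈-sym a′≈) code
          decoded′ = ≈-sym (≈-trans (decode-resp a′≈) decoded)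
      in begin
        1                           ≡⟨ cong₂ _*_ (𝟙-yes (code? a′ π q) code′)
                                                   (𝟙-yes (a ≈? decode π q a′) decoded′) ⟨
        codes a′ π q a              ≤⟨ ∑-≥-∈ (λ q → codes a′ π q a) q∈Qs ⟩
        ∑[ q ∈ Qs ] codes a′ π q a  ∎
      where open ≤-Reasoning

    ∑-once : ∀ c b → ∑[ a ∈ L ] (c * 𝟙 (a ≈? b)) ≡ c
    ∑-once c b = trans (∑-*ˡ c L (λ a → 𝟙 (a ≈? b))) (trans (cong (c *_) (L-once b)) (*-identityʳ c))

  double-counting : ∀ m → (∀ {a} → Bad a → m ≤ ∑[ π ∈ Ps ] 𝟙 (move? a π)) →
    m * ∑[ a ∈ L ] 𝟙 (bad? a) ≤ ∑[ a′ ∈ L ] ∑[ π ∈ Ps ] ∑[ q ∈ Qs ] 𝟙 (code? a′ π q)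
  double-counting m m≤ = begin
    m * ∑[ a ∈ L ] 𝟙 (bad? a)
      ≡⟨ ∑-*ˡ m L (λ a → 𝟙 (bad? a)) ⟨
    ∑[ a ∈ L ] (m * 𝟙 (bad? a))
      ≤⟨ ∑-mono-≤ L (weighted-moves m m≤) ⟩
    ∑[ a ∈ L ] ∑[ π ∈ Ps ] moves a π
      ≡⟨ ∑-cong L (λ a → ∑-cong Ps (λ π → ∑-once (moves a π) (apply π a))) ⟨
    ∑[ a ∈ L ] ∑[ π ∈ Ps ] ∑[ a′ ∈ L ] (moves a π * 𝟙 (a′ ≈? apply π a))
      ≡⟨ trans (∑-cong L (λ a → ∑-swap Ps L _)) (trans (∑-swap L L _) (∑-cong L (λ a′ → ∑-swap L Ps _))) ⟩
    ∑[ a′ ∈ L ] ∑[ π ∈ Ps ] ∑[ a ∈ L ] (moves a π * 𝟙 (a′ ≈? apply π a))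
      ≤⟨ ∑-mono-≤ L (λ a′ → ∑-mono-≤ Ps (λ π → ∑-mono-≤ L (λ a → move-encoded a π a′))) ⟩
    ∑[ a′ ∈ L ] ∑[ π ∈ Ps ] ∑[ a ∈ L ] ∑[ q ∈ Qs ] codes a′ π q a
      ≡⟨ ∑-cong L (λ a′ → ∑-cong Ps (λ π → ∑-swap L Qs (λ a q → codes a′ π q a))) ⟩
    ∑[ a′ ∈ L ] ∑[ π ∈ Ps ] ∑[ q ∈ Qs ] ∑[ a ∈ L ] codes a′ π q a
      ≡⟨ ∑-cong L (λ a′ → ∑-cong Ps (λ π → ∑-cong Qs (λ q →
           ∑-once (𝟙 (code? a′ π q)) (decode π q a′)))) ⟩
    ∑[ a′ ∈ L ] ∑[ π ∈ Ps ] ∑[ q ∈ Qs ] 𝟙 (code? a′ π q) ∎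
    where open ≤-Reasoning

  rarity : ∀ k C .{{_ : NonZero C}} {Class : A → Set} (class? : U.Decidable Class) →
    (∀ {a} → Bad a → k * C ≤ ∑[ π ∈ Ps ] 𝟙 (move? a π)) →
    (∀ a′ → ∑[ π ∈ Ps ] ∑[ q ∈ Qs ] 𝟙 (code? a′ π q) ≤ C * 𝟙 (class? a′)) →
    k * ∑[ a ∈ L ] 𝟙 (bad? a) ≤ ∑[ a ∈ L ] 𝟙 (class? a)
  rarity k C class? many-moves few-codes = *-cancelˡ-≤ C (begin
    C * (k * #bad)                                         ≡⟨ *-assoc C k #bad ⟨
    C * k * #bad                                           ≡⟨ cong (_* #bad) (*-comm C k) ⟩
    k * C * #bad                                           ≤⟨ double-counting (k * C) many-moves ⟩
    ∑[ a′ ∈ L ] ∑[ π ∈ Ps ] ∑[ q ∈ Qs ] 𝟙 (code? a′ π q)  ≤⟨ ∑-mono-≤ L few-codes ⟩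
    ∑[ a′ ∈ L ] (C * 𝟙 (class? a′))                       ≡⟨ ∑-*ˡ C L (λ a′ → 𝟙 (class? a′)) ⟩
    C * ∑[ a ∈ L ] 𝟙 (class? a)                            ∎)
    where
    open ≤-Reasoning
    #bad = ∑[ a ∈ L ] 𝟙 (bad? a)

-- Triangles and bipartitions

odd : Fin 4 → Bool
odd 0F = false
odd 1F = true
odd 2F = false
odd 3F = true

Triangle : Fin 4 → Fin 4 → Fin 4 → Set
Triangle i j k = AllowedTriangle (toℕ i , toℕ j , toℕ k)

triangle? : ∀ i j k → Dec (Triangle i j k)
triangle? i j k = allowed? (toℕ i , toℕ j , toℕ k)

-- Each of the following five facts is proved by evaluating its decision procedure on all
-- 4³ triples of entries.

triangle-parity : ∀ i j k → Triangle i j k → odd k ≡ odd i xor odd j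
triangle-parity = from-yes (all? λ i → all? λ j → all? λ k →
  triangle? i j k →-dec odd k Bool.≟ odd i xor odd j)

triangle-single-3 : ∀ i j k → Triangle i j k → ¬ (i ≡ 3F × j ≡ 3F)
triangle-single-3 = from-yes (all? λ i → all? λ j → all? λ k →
  triangle? i j k →-dec ¬? (i ≟ 3F ×-dec j ≟ 3F))

triangle-inequality : ∀ i j k → Triangle i j k → toℕ j ≤ toℕ i + toℕ k
triangle-inequality = from-yes (all? λ i → all? λ j → all? λ k →
  triangle? i j k →-dec toℕ j ≤? toℕ i + toℕ k)

triangle-2s : ∀ i j k → Triangle i j k →
  (toℕ i ≡ 2 × toℕ j ≡ 2 × toℕ k ≡ 2) ⊎ ExactlyOneIs2 (toℕ i) (toℕ j) (toℕ k)
triangle-2s = from-yes (all? λ i → all? λ j → all? λ k → triangle? i j k →-dec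
  ((is2 i ×-dec is2 j ×-dec is2 k) ⊎-dec
   (is2 i ×-dec ¬? (is2 j) ×-dec ¬? (is2 k)) ⊎-dec
   (¬? (is2 i) ×-dec is2 j ×-dec ¬? (is2 k)) ⊎-dec
   (¬? (is2 i) ×-dec ¬? (is2 j) ×-dec is2 k)))
  where
  is2 : ∀ i → Dec (toℕ i ≡ 2)
  is2 i = toℕ i ℕ.≟ 2

parity-triangle : ∀ i j k → i ≢ 0F → j ≢ 0F → k ≢ 0F → odd k ≡ odd i xor odd j →
  ¬ (i ≡ 3F × j ≡ 3F) → ¬ (i ≡ 3F × k ≡ 3F) → ¬ (j ≡ 3F × k ≡ 3F) → Triangle i j k
parity-triangle = from-yes (all? λ i → all? λ j → all? λ k →
  ¬? (i ≟ 0F) →-dec ¬? (j ≟ 0F) →-dec ¬? (k ≟ 0F) →-dec odd k Bool.≟ odd i xor odd j →-dec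
  ¬? (i ≟ 3F ×-dec j ≟ 3F) →-dec ¬? (i ≟ 3F ×-dec k ≟ 3F) →-dec ¬? (j ≟ 3F ×-dec k ≟ 3F) →-dec
  triangle? i j k)

xor-cancelˡ : ∀ a b c → (a xor b) xor (a xor c) ≡ b xor c
xor-cancelˡ false b c = refl
xor-cancelˡ true true c = refl
xor-cancelˡ true false c = Bool.not-involutive c

nonzero-distance : ∀ (i : Fin 4) → i ≢ 0F → toℕ i ≡ 1 ⊎ toℕ i ≡ 2 ⊎ toℕ i ≡ 3
nonzero-distance 0F i≢0 = contradiction refl i≢0
nonzero-distance 1F _ = inj₁ refl
nonzero-distance 2F _ = inj₂ (inj₁ refl)
nonzero-distance 3F _ = inj₂ (inj₂ refl)

record Bipartition (M : Mat n) (side : Fin n → Bool) : Set where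
  field
    diagonal  : ∀ a → M a a ≡ 0F
    symmetric : ∀ a b → M a b ≡ M b a
    nonzero   : ∀ {a b} → a ≢ b → M a b ≢ 0F
    parity    : ∀ {a b} → a ≢ b → odd (M a b) ≡ side a xor side b
    matching  : ∀ {a b e} → M a b ≡ 3F → M a e ≡ 3F → b ≡ e

private variable
  M N : Mat n
  side : Fin n → Bool

module _ (B : Bipartition M side) where
  open Bipartition B

  bipartition-triangle : ∀ {x y z} → Distinct3 x y z → Triangle (M x y) (M x z) (M y z)
  bipartition-triangle {x} {y} {z} (x≢y , x≢z , y≢z) =
    parity-triangle (M x y) (M x z) (M y z) (nonzero x≢y) (nonzero x≢z) (nonzero y≢z) perimeter
      (λ (xy3 , xz3) → y≢z (matching xy3 xz3))
      (λ (xy3 , yz3) → x≢z (matching (trans (symmetric y x) xy3) yz3))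
      (λ (xz3 , yz3) → x≢y (matching (trans (symmetric z x) xz3) (trans (symmetric z y) yz3)))
    where
    perimeter : odd (M y z) ≡ odd (M x y) xor odd (M x z)
    perimeter rewrite parity x≢y | parity x≢z | parity y≢z = sym (xor-cancelˡ (side x) (side y) (side z))

  bipartition-inequality : ∀ x y z → d M x z ≤ d M x y + d M y z
  bipartition-inequality x y z with x ≟ y | y ≟ z | x ≟ z
  ... | yes refl | _ | _ rewrite diagonal x = ≤-refl
  ... | no _ | yes refl | _ rewrite diagonal y = m≤m+n (d M x y) 0
  ... | no _ | no _ | yes refl rewrite diagonal x = z≤n
  ... | no x≢y | no y≢z | no x≢z =
    triangle-inequality (M x y) (M x z) (M y z) (bipartition-triangle (x≢y , x≢z , y≢z))

  bipartition⇒inClass : InClass M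
  bipartition⇒inClass =
    ( (λ a → cong toℕ (diagonal a))
    , (λ a b a≢b → nonzero a≢b ∘ toℕ-injective)
    , (λ a b → cong toℕ (symmetric a b))
    , bipartition-inequality )
    , (λ a b a≢b → nonzero-distance (M a b) (nonzero a≢b))
    , λ x y z → bipartition-triangle

module _ (C : InClass M) where

  private
    diagonal : ∀ a → M a a ≡ 0F
    diagonal a = toℕ-injective (proj₁ (proj₁ C) a)

    triangle : ∀ {x y z} → Distinct3 x y z → Triangle (M x y) (M x z) (M y z)
    triangle = proj₂ (proj₂ C) _ _ _

    3⇒distinct : ∀ {a b} → M a b ≡ 3F → a ≢ b
    3⇒distinct {a} ab3 refl with trans (sym (diagonal a)) ab3
    ... | ()

  inClass-symmetric : ∀ a b → M a b ≡ M b a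
  inClass-symmetric a b = toℕ-injective (proj₁ (proj₂ (proj₂ (proj₁ C))) a b)

  inClass-matching : ∀ {a b e} → M a b ≡ 3F → M a e ≡ 3F → b ≡ e
  inClass-matching {a} {b} {e} ab3 ae3 with b ≟ e
  ... | yes b≡e = b≡e
  ... | no b≢e = contradiction (ab3 , ae3)
    (triangle-single-3 _ _ _ (triangle (3⇒distinct ab3 , 3⇒distinct ae3 , b≢e)))

  inClass⇒bipartition : ∀ o → Bipartition M (odd ∘ M o)
  inClass⇒bipartition o = record
    { diagonal  = diagonal
    ; symmetric = inClass-symmetric
    ; nonzero   = λ {a} {b} a≢b → proj₁ (proj₂ (proj₁ C)) a b a≢b ∘ cong toℕ
    ; parity    = parity
    ; matching  = inClass-matching
    }
    where
    parity : ∀ {a b} → a ≢ b → odd (M a b) ≡ odd (M o a) xor odd (M o b)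
    parity {a} {b} a≢b with a ≟ o | b ≟ o
    ... | yes refl | _ rewrite diagonal a = refl
    ... | no _ | yes refl rewrite diagonal b | inClass-symmetric a b = sym (Bool.xor-identityʳ _)
    ... | no a≢o | no b≢o = triangle-parity _ _ _ (triangle (a≢o ∘ sym , b≢o ∘ sym , a≢b))

InClass-resp : M ≋ N → InClass M → InClass N
InClass-resp {M = M} {N} M≋N ((diagonal , nonzero , symmetric , inequality) , distances , triangles) =
  ( (λ a → trans (sym (d≡ a a)) (diagonal a))
  , (λ a b a≢b → nonzero a b a≢b ∘ trans (d≡ a b))
  , (λ a b → trans (sym (d≡ a b)) (trans (symmetric a b) (d≡ b a)))
  , (λ x y z → subst₂ _≤_ (d≡ x z) (cong₂ _+_ (d≡ x y) (d≡ y z)) (inequality x y z)) )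
  , (λ a b a≢b → subst (λ δ → δ ≡ 1 ⊎ δ ≡ 2 ⊎ δ ≡ 3) (d≡ a b) (distances a b a≢b))
  , λ x y z xyz → subst AllowedTriangle (cong₂ _,_ (d≡ x y) (cong₂ _,_ (d≡ x z) (d≡ y z)))
                                        (triangles x y z xyz)
  where
  d≡ : ∀ a b → d M a b ≡ d N a b
  d≡ a b = cong toℕ (M≋N a b)

-- Relocating a point

data Cell (y a b : Fin n) : Set where
  in-row    : a ≡ y → Cell y a b
  in-column : a ≢ y → b ≡ y → Cell y a b
  elsewhere : a ≢ y → b ≢ y → Cell y a b

cell : ∀ (y a b : Fin n) → Cell y a b
cell y a b with a ≟ y | b ≟ y
... | yes a≡y | _       = in-row a≡y
... | no a≢y  | yes b≡y = in-column a≢y b≡y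
... | no a≢y  | no b≢y  = elsewhere a≢y b≢y

-- Opaque, so that unification treats relocate as rigid; it is only used through the three
-- equations proved inside the block.
opaque
  relocate : Fin n → (Fin n → Fin 4) → Mat n → Mat n
  relocate y r M a b with a ≟ y | b ≟ y
  ... | yes _ | _     = r b
  ... | no _  | yes _ = r a
  ... | no _  | no _  = M a b

  relocate-row : ∀ {y : Fin n} {r M} b → relocate y r M y b ≡ r b
  relocate-row {y = y} b with y ≟ y
  ... | yes _ = refl
  ... | no y≢y = contradiction refl y≢y

  relocate-column : ∀ {y : Fin n} {r M a} → a ≢ y → relocate y r M a y ≡ r a
  relocate-column {y = y} {a = a} a≢y with a ≟ y | y ≟ y
  ... | yes a≡y | _ = contradiction a≡y a≢y
  ... | no _ | yes _ = refl
  ... | no _ | no y≢y = contradiction refl y≢y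

  relocate-elsewhere : ∀ {y : Fin n} {r M a b} → a ≢ y → b ≢ y → relocate y r M a b ≡ M a b
  relocate-elsewhere {y = y} {a = a} {b} a≢y b≢y with a ≟ y | b ≟ y
  ... | yes a≡y | _ = contradiction a≡y a≢y
  ... | no _ | yes b≡y = contradiction b≡y b≢y
  ... | no _ | no _ = refl

relocate-cong : ∀ {y : Fin n} {r r′ M M′} → (∀ b → r b ≡ r′ b) → M ≋ M′ →
  relocate y r M ≋ relocate y r′ M′
relocate-cong {y = y} r≗r′ M≋M′ a b with cell y a b
... | in-row refl = trans (relocate-row b) (trans (r≗r′ b) (sym (relocate-row b)))
... | in-column a≢y refl = trans (relocate-column a≢y) (trans (r≗r′ a) (sym (relocate-column a≢y)))
... | elsewhere a≢y b≢y =
  trans (relocate-elsewhere a≢y b≢y) (trans (M≋M′ a b) (sym (relocate-elsewhere a≢y b≢y)))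

relocate-twice : ∀ {y : Fin n} {r r′ M} → relocate y r (relocate y r′ M) ≋ relocate y r M
relocate-twice {y = y} a b with cell y a b
... | in-row refl = trans (relocate-row b) (sym (relocate-row b))
... | in-column a≢y refl = trans (relocate-column a≢y) (sym (relocate-column a≢y))
... | elsewhere a≢y b≢y = trans (relocate-elsewhere a≢y b≢y)
  (trans (relocate-elsewhere a≢y b≢y) (sym (relocate-elsewhere a≢y b≢y)))

relocate-own : ∀ {y : Fin n} {r M} → (∀ b → r b ≡ M y b) → (∀ a → M a y ≡ M y a) → relocate y r M ≋ M
relocate-own {y = y} r≗My sym-y a b with cell y a b
... | in-row refl = trans (relocate-row b) (r≗My b)
... | in-column a≢y refl = trans (relocate-column a≢y) (trans (r≗My a) (sym (sym-y a)))
... | elsewhere a≢y b≢y = relocate-elsewhere a≢y b≢y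

relocate-3 : ∀ {y : Fin n} {r M a b} → (∀ b → r b ≢ 3F) → relocate y r M a b ≡ 3F →
  a ≢ y × b ≢ y × M a b ≡ 3F
relocate-3 {y = y} {a = a} {b} r≢3 ab3 with cell y a b
... | in-row refl = contradiction (trans (sym (relocate-row b)) ab3) (r≢3 b)
... | in-column a≢y refl = contradiction (trans (sym (relocate-column a≢y)) ab3) (r≢3 a)
... | elsewhere a≢y b≢y = a≢y , b≢y , trans (sym (relocate-elsewhere a≢y b≢y)) ab3

record Admissible (M : Mat n) (side : Fin n → Bool) (y : Fin n) (r : Fin n → Fin 4) : Set where
  field
    self         : r y ≡ 0F
    nonzero      : ∀ {b} → b ≢ y → r b ≢ 0F
    parity       : ∀ {b} → b ≢ y → odd (r b) ≡ side y xor side b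
    matching     : ∀ {b e} → r b ≡ 3F → r e ≡ 3F → b ≡ e
    partner-free : ∀ {b e} → r b ≡ 3F → M b e ≡ 3F → e ≡ y

relocate-bipartition : ∀ {y r} {side′ : Fin n → Bool} → Bipartition M side →
  (∀ {b} → b ≢ y → side′ b ≡ side b) → Admissible M side′ y r → Bipartition (relocate y r M) side′
relocate-bipartition {M = M} {side} {y} {r} {side′} B side′≗side R = record
  { diagonal  = diagonal
  ; symmetric = symmetric
  ; nonzero   = nonzero
  ; parity    = parity
  ; matching  = matching
  }
  where
  module B = Bipartition B
  module R = Admissible R
  M′ = relocate y r M

  diagonal : ∀ a → M′ a a ≡ 0F
  diagonal a with cell y a a
  ... | in-row refl = trans (relocate-row _) R.self
  ... | in-column a≢y a≡y = contradiction a≡y a≢y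
  ... | elsewhere a≢y _ = trans (relocate-elsewhere a≢y a≢y) (B.diagonal a)

  symmetric : ∀ a b → M′ a b ≡ M′ b a
  symmetric a b with cell y a b | cell y b a
  ... | in-row refl | in-row refl = refl
  ... | in-row refl | in-column b≢y _ = trans (relocate-row _) (sym (relocate-column b≢y))
  ... | in-column a≢y refl | in-row _ = trans (relocate-column a≢y) (sym (relocate-row _))
  ... | elsewhere a≢y b≢y | _ =
    trans (relocate-elsewhere a≢y b≢y) (trans (B.symmetric a b) (sym (relocate-elsewhere b≢y a≢y)))
  ... | in-row refl | elsewhere _ y≢y = contradiction refl y≢y
  ... | in-column _ refl | in-column y≢y _ = contradiction refl y≢y
  ... | in-column _ refl | elsewhere y≢y _ = contradiction refl y≢y

  nonzero : ∀ {a b} → a ≢ b → M′ a b ≢ 0F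
  nonzero {a} {b} a≢b with cell y a b
  ... | in-row refl = R.nonzero (a≢b ∘ sym) ∘ trans (sym (relocate-row _))
  ... | in-column a≢y refl = R.nonzero a≢y ∘ trans (sym (relocate-column a≢y))
  ... | elsewhere a≢y b≢y = B.nonzero a≢b ∘ trans (sym (relocate-elsewhere a≢y b≢y))

  parity : ∀ {a b} → a ≢ b → odd (M′ a b) ≡ side′ a xor side′ b
  parity {a} {b} a≢b with cell y a b
  ... | in-row refl = trans (cong odd (relocate-row _)) (R.parity (a≢b ∘ sym))
  ... | in-column a≢y refl =
    trans (cong odd (relocate-column a≢y)) (trans (R.parity a≢y) (Bool.xor-comm (side′ y) (side′ a)))
  ... | elsewhere a≢y b≢y = begin
    odd (M′ a b)         ≡⟨ cong odd (relocate-elsewhere a≢y b≢y) ⟩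
    odd (M a b)          ≡⟨ B.parity a≢b ⟩
    side a xor side b    ≡⟨ cong₂ _xor_ (side′≗side a≢y) (side′≗side b≢y) ⟨
    side′ a xor side′ b  ∎
    where open ≡-Reasoning

  matching : ∀ {a b e} → M′ a b ≡ 3F → M′ a e ≡ 3F → b ≡ e
  matching {a} {b} {e} ab3 ae3 with cell y a b | cell y a e
  ... | in-row refl | _ =
    R.matching (trans (sym (relocate-row _)) ab3) (trans (sym (relocate-row _)) ae3)
  ... | in-column _ refl | in-column _ refl = refl
  ... | in-column a≢y refl | elsewhere _ e≢y = sym (R.partner-free
    (trans (sym (relocate-column a≢y)) ab3) (trans (sym (relocate-elsewhere a≢y e≢y)) ae3))
  ... | elsewhere a≢y b≢y | in-column _ refl = R.partner-free
    (trans (sym (relocate-column a≢y)) ae3) (trans (sym (relocate-elsewhere a≢y b≢y)) ab3)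
  ... | elsewhere a≢y b≢y | elsewhere _ e≢y = B.matching
    (trans (sym (relocate-elsewhere a≢y b≢y)) ab3) (trans (sym (relocate-elsewhere a≢y e≢y)) ae3)
  ... | in-column a≢y _ | in-row a≡y = contradiction a≡y a≢y
  ... | elsewhere a≢y _ | in-row a≡y = contradiction a≡y a≢y

across : Bool → Fin 4
across true = 1F
across false = 2F

odd-across : ∀ s → odd (across s) ≡ s
odd-across true = refl
odd-across false = refl

across-odd : ∀ i → i ≢ 0F → i ≢ 3F → i ≡ across (odd i)
across-odd 0F i≢0 _ = contradiction refl i≢0
across-odd 1F _ _ = refl
across-odd 2F _ _ = refl
across-odd 3F _ i≢3 = contradiction refl i≢3

across≢0 : ∀ s → across s ≢ 0F
across≢0 true ()
across≢0 false ()

across≢3 : ∀ s → across s ≢ 3F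
across≢3 true ()
across≢3 false ()

Matched : Mat n → Fin n → Set
Matched M x = ∃[ y ] M x y ≡ 3F

matched? : ∀ (M : Mat n) → U.Decidable (Matched M)
matched? M x = any? λ y → M x y ≟ 3F

#matched #unmatched : Mat n → ℕ
#matched {n} M = ∑[ x ∈ allFin n ] 𝟙 (matched? M x)
#unmatched {n} M = ∑[ x ∈ allFin n ] 𝟙 (¬? (matched? M x))

#matched+#unmatched : ∀ (M : Mat n) → #matched M + #unmatched M ≡ n
#matched+#unmatched {n} M = begin
  #matched M + #unmatched M
    ≡⟨ ∑-distrib-+ (allFin n) ⟨
  ∑[ x ∈ allFin n ] (𝟙 (matched? M x) + 𝟙 (¬? (matched? M x)))
    ≡⟨ ∑-cong (allFin n) (𝟙-excluded-middle ∘ matched? M) ⟩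
  ∑[ x ∈ allFin n ] 1
    ≡⟨ ∑-allFin-1 n ⟩
  n ∎
  where open ≡-Reasoning

Matched-resp : ∀ {x} → M ≋ N → Matched M x → Matched N x
Matched-resp {x = x} M≋N (y , xy3) = y , trans (sym (M≋N x y)) xy3

#unmatched-resp : M ≋ N → #unmatched M ≡ #unmatched N
#unmatched-resp {n} {M} {N} M≋N = ∑-cong (allFin n) λ x →
  𝟙-cong (¬? (matched? M x)) (¬? (matched? N x))
    (λ free → free ∘ Matched-resp (≋.sym M≋N)) (λ free → free ∘ Matched-resp M≋N)

unmatched-row : Bipartition M side → ∀ {x b} → ¬ Matched M x → b ≢ x → M x b ≡ across (side x xor side b)
unmatched-row {M = M} B {x} {b} free b≢x =
  trans (across-odd (M x b) (nonzero (b≢x ∘ sym)) (λ xb3 → free (b , xb3)))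
        (cong across (parity (b≢x ∘ sym)))
  where open Bipartition B

Bad : ∀ {p} → Sentence p → Mat n → Set
Bad φ M = InClass M × ¬ Sat φ M

bad? : ∀ {p} (φ : Sentence p) → U.Decidable (Bad {n} φ)
bad? φ M = inClass? M ×-dec ¬? (sat? φ M)

#bad : ∀ {p} → Sentence p → ℕ → ℕ
#bad φ n = ∑[ M ∈ allMats n ] 𝟙 (bad? φ M)

total≡∑ : ∀ n → total n ≡ ∑[ M ∈ allMats n ] 𝟙 (inClass? M)
total≡∑ n = length-filter inClass? (allMats n)

total∸good≡#bad : ∀ {p} (φ : Sentence p) n → total n ∸ good φ n ≡ #bad φ n
total∸good≡#bad φ n = begin
  total n ∸ good φ n          ≡⟨ cong₂ _∸_ total≡good+bad (length-filter good? (allMats n)) ⟩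
  (#good + #bad φ n) ∸ #good  ≡⟨ m+n∸m≡n #good (#bad φ n) ⟩
  #bad φ n                    ∎
  where
  open ≡-Reasoning
  good? = λ M → inClass? M ×-dec sat? φ M
  #good = ∑[ M ∈ allMats n ] 𝟙 (good? M)
  total≡good+bad : total n ≡ #good + #bad φ n
  total≡good+bad = trans (total≡∑ n)
    (trans (∑-cong (allMats n) (λ M → 𝟙-split (inClass? M) (sat? φ M))) (∑-distrib-+ (allMats n)))

never-bad : ∀ {p} (φ : Sentence p) → (∀ {n} {M : Mat n} → InClass M → Sat φ M) →
  ∀ k n → k * #bad φ n ≤ total n
never-bad φ sat k n rewrite ∑-cong (allMats n) (λ M → 𝟙-no (bad? φ M) λ (C , ¬sat) → ¬sat (sat C))
                          | ∑-zero (allMats n) | *-zeroʳ k = z≤n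

module _ {p : ℕ} {M : Mat n} (C : InClass M) where

  inClass⇒φ1 : Sat {p} φ1 M
  inClass⇒φ1 = proj₁ (proj₂ C)

  inClass⇒φ2 : Sat {p} φ2 M
  inClass⇒φ2 x y z y≢z (xy3 , xz3) = y≢z (inClass-matching C (toℕ-injective xy3) (toℕ-injective xz3))

  inClass⇒φ3 : Sat {p} φ3 M
  inClass⇒φ3 x y z xyz = triangle-2s _ _ _ (proj₂ (proj₂ C) x y z xyz)

  many-unmatched⇒φ5 : p ≤ #unmatched M → Sat {p} φ5 M
  many-unmatched⇒φ5 p≤ with distinct-witnesses (¬? ∘ matched? M) p p≤
  ... | u , distinct , free = u , distinct , λ i v v≢ui ≢2 →
    distance-1 (proj₁ (proj₂ C) (lookup u i) v (v≢ui ∘ sym)) ≢2 (λ ≡3 → free i (v , toℕ-injective ≡3))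
    where
    distance-1 : ∀ {δ} → δ ≡ 1 ⊎ δ ≡ 2 ⊎ δ ≡ 3 → δ ≢ 2 → δ ≢ 3 → δ ≡ 1
    distance-1 (inj₁ δ≡1) _ _ = δ≡1
    distance-1 (inj₂ (inj₁ δ≡2)) δ≢2 _ = contradiction δ≡2 δ≢2
    distance-1 (inj₂ (inj₂ δ≡3)) _ δ≢3 = contradiction δ≡3 δ≢3

  many-matched⇒φ4 : p ≤ #matched M → Sat {p} φ4 M
  many-matched⇒φ4 p≤ with distinct-witnesses (matched? M) p p≤
  ... | u , distinct , matched = u , v , distinct , v-distinct , λ i → cong toℕ (u-v i)
    where
    v = Vec.tabulate (proj₁ ∘ matched)

    u-v : ∀ i → M (lookup u i) (lookup v i) ≡ 3F
    u-v i = trans (cong (M (lookup u i)) (lookup∘tabulate _ i)) (proj₂ (matched i))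

    v-u : ∀ i → M (lookup v i) (lookup u i) ≡ 3F
    v-u i = trans (inClass-symmetric C _ _) (u-v i)

    v-distinct : Distinct v
    v-distinct i j i≢j vi≡vj =
      distinct i j i≢j (inClass-matching C (v-u i) (trans (cong (λ w → M w _) vi≡vj) (v-u j)))

few-unmatched : ∀ {p} {M : Mat n} → Bad {p = p} φ5 M → #unmatched M < p
few-unmatched (C , ¬sat) = ≰⇒> (¬sat ∘ many-unmatched⇒φ5 C)

few-matched : ∀ {p} {M : Mat n} → Bad {p = p} φ4 M → #matched M < p
few-matched (C , ¬sat) = ≰⇒> (¬sat ∘ many-matched⇒φ4 C)

-- Sentence (5): unmatching a point

shorten : Fin 4 → Fin 4
shorten 3F = 1F
shorten i = i

odd-shorten : ∀ i → odd (shorten i) ≡ odd i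
odd-shorten 0F = refl
odd-shorten 1F = refl
odd-shorten 2F = refl
odd-shorten 3F = refl

shorten-nonzero : ∀ {i} → i ≢ 0F → shorten i ≢ 0F
shorten-nonzero {0F} i≢0 = i≢0
shorten-nonzero {1F} i≢0 = i≢0
shorten-nonzero {2F} i≢0 = i≢0
shorten-nonzero {3F} _ ()

shorten≢3 : ∀ i → shorten i ≢ 3F
shorten≢3 3F ()

shorten-id : ∀ {i} → i ≢ 3F → shorten i ≡ i
shorten-id {0F} _ = refl
shorten-id {1F} _ = refl
shorten-id {2F} _ = refl
shorten-id {3F} i≢3 = contradiction refl i≢3

updateAt-cong : ∀ {xs ys : Fin n → A} i {f : A → A} → (∀ j → xs j ≡ ys j) →
  ∀ j → updateAt xs i f j ≡ updateAt ys i f j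
updateAt-cong {xs = xs} {ys} i {f} xs≗ys j with j ≟ i
... | yes refl = trans (updateAt-updates j xs) (trans (cong f (xs≗ys j)) (sym (updateAt-updates j ys)))
... | no j≢i = trans (updateAt-minimal j i xs j≢i) (trans (xs≗ys j) (sym (updateAt-minimal j i ys j≢i)))

unmatch : Fin n → Mat n → Mat n
unmatch x M = relocate x (shorten ∘ M x) M

rematch : Fin n → Fin n → Mat n → Mat n
rematch x y M = relocate x (updateAt (M x) y (const 3F)) M

module _ (B : Bipartition M side) {x y : Fin n} (xy3 : M x y ≡ 3F) where
  open Bipartition B

  private
    M′ = unmatch x M

  unmatch-bipartition : Bipartition M′ side
  unmatch-bipartition = relocate-bipartition B (λ _ → refl) record
    { self         = cong shorten (diagonal x)
    ; nonzero      = λ b≢x → shorten-nonzero (nonzero (b≢x ∘ sym))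
    ; parity       = λ b≢x → trans (odd-shorten _) (parity (b≢x ∘ sym))
    ; matching     = λ {b} b3 → contradiction b3 (shorten≢3 (M x b))
    ; partner-free = λ {b} b3 → contradiction b3 (shorten≢3 (M x b))
    }

  rematch-unmatch : rematch x y M′ ≋ M
  rematch-unmatch = ≋.trans relocate-twice (relocate-own restored λ a → symmetric a x)
    where
    restored : ∀ b → updateAt (M′ x) y (const 3F) b ≡ M x b
    restored b with b ≟ y
    ... | yes refl = trans (updateAt-updates b (M′ x)) (sym xy3)
    ... | no b≢y = trans (updateAt-minimal b y (M′ x) b≢y)
      (trans (relocate-row _) (shorten-id λ xb3 → b≢y (sym (matching xy3 xb3))))

  unmatch-frees-x : ¬ Matched M′ x
  unmatch-frees-x (b , xb3) = proj₁ (relocate-3 (shorten≢3 ∘ M x) xb3) refl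

  unmatch-frees-y : ¬ Matched M′ y
  unmatch-frees-y (b , yb3) =
    let _ , b≢x , yb3′ = relocate-3 (shorten≢3 ∘ M x) yb3
    in b≢x (sym (matching (trans (symmetric y x) xy3) yb3′))

  unmatch-keeps : ∀ {z} → z ≢ x → z ≢ y → Matched M z → Matched M′ z
  unmatch-keeps {z} z≢x z≢y (b , zb3) with b ≟ x
  ... | yes refl = contradiction (matching (trans (symmetric x z) zb3) xy3) z≢y
  ... | no b≢x = b , trans (relocate-elsewhere z≢x b≢x) zb3

  #unmatched-unmatch : #unmatched M′ ≤ #unmatched M + 2
  #unmatched-unmatch = begin
    #unmatched M′
      ≤⟨ ∑-mono-≤ (allFin n) (λ z →
           ≤-trans (𝟙-⊎ (¬? (matched? M′ z)) (¬? (matched? M z)) (z ≟ x ⊎-dec z ≟ y) (freed z))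
                   (+-monoʳ-≤ (𝟙 (¬? (matched? M z))) (𝟙-⊎ (z ≟ x ⊎-dec z ≟ y) (z ≟ x) (z ≟ y) id))) ⟩
    ∑[ z ∈ allFin n ] (𝟙 (¬? (matched? M z)) + (𝟙 (z ≟ x) + 𝟙 (z ≟ y)))
      ≡⟨ trans (∑-distrib-+ (allFin n)) (cong (#unmatched M +_) (∑-distrib-+ (allFin n))) ⟩
    #unmatched M + (∑[ z ∈ allFin n ] 𝟙 (z ≟ x) + ∑[ z ∈ allFin n ] 𝟙 (z ≟ y))
      ≡⟨ cong (#unmatched M +_) (cong₂ _+_ (∑-allFin-once x) (∑-allFin-once y)) ⟩
    #unmatched M + 2 ∎
    where
    open ≤-Reasoning
    freed : ∀ z → ¬ Matched M′ z → ¬ Matched M z ⊎ (z ≡ x ⊎ z ≡ y)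
    freed z free′ with z ≟ x | z ≟ y
    ... | yes z≡x | _ = inj₂ (inj₁ z≡x)
    ... | no _ | yes z≡y = inj₂ (inj₂ z≡y)
    ... | no z≢x | no z≢y = inj₁ (free′ ∘ unmatch-keeps z≢x z≢y)

φ5-rare : ∀ p k n → k * (suc p * suc p) + p ≤ n → k * #bad (φ5 {p}) n ≤ total n
φ5-rare p k n n≥ = subst (k * #bad (φ5 {p}) n ≤_) (sym (total≡∑ n))
  (rarity k (suc p * suc p) inClass? many-moves few-codes)
  where
  Code : Mat n → Fin n → Fin n → Set
  Code M x y = (InClass M × #unmatched M ≤ suc p) × ¬ Matched M x × ¬ Matched M y

  code? : ∀ M x y → Dec (Code M x y)
  code? M x y = (inClass? M ×-dec #unmatched M ≤? suc p) ×-dec ¬? (matched? M x) ×-dec ¬? (matched? M y)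

  code-resp : ∀ {M N x y} → M ≋ N → Code M x y → Code N x y
  code-resp M≋N ((C , few) , free-x , free-y) =
    (InClass-resp M≋N C , subst (_≤ suc p) (#unmatched-resp M≋N) few)
    , free-x ∘ Matched-resp (≋.sym M≋N) , free-y ∘ Matched-resp (≋.sym M≋N)

  decodable : ∀ {M x} → Bad (φ5 {p}) M → Matched M x →
    ∃[ y ] y ∈ allFin n × Code (unmatch x M) x y × rematch x y (unmatch x M) ≋ M
  decodable {M} {x} bad@(C , _) (y , xy3) =
    y , ∈-tabulate⁺ y
    , ((bipartition⇒inClass (unmatch-bipartition parts xy3) , few)
      , unmatch-frees-x parts xy3 , unmatch-frees-y parts xy3)
    , rematch-unmatch parts xy3
    where
    parts = inClass⇒bipartition C x
    few : #unmatched (unmatch x M) ≤ suc p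
    few = ≤-trans (#unmatched-unmatch parts xy3)
      (≤-trans (≤-reflexive (+-comm (#unmatched M) 2)) (s≤s (few-unmatched bad)))

  open DoubleCounting ≋-isEquivalence _≋?_ (allMats n) allMats-once (bad? (φ5 {p})) (allFin n) matched?
    (allFin n) code? unmatch rematch code-resp
    (λ M≋N → relocate-cong (updateAt-cong _ (M≋N _)) M≋N) decodable

  many-moves : ∀ {M} → Bad (φ5 {p}) M → k * (suc p * suc p) ≤ #matched M
  many-moves {M} bad = +-cancelʳ-≤ p _ _ (begin
    k * (suc p * suc p) + p    ≤⟨ n≥ ⟩
    n                          ≡⟨ #matched+#unmatched M ⟨
    #matched M + #unmatched M  ≤⟨ +-monoʳ-≤ (#matched M) (<⇒≤ (few-unmatched bad)) ⟩
    #matched M + p             ∎)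
    where open ≤-Reasoning

  few-codes : ∀ M → ∑[ x ∈ allFin n ] ∑[ y ∈ allFin n ] 𝟙 (code? M x y) ≤ (suc p * suc p) * 𝟙 (inClass? M)
  few-codes M = begin
    ∑[ x ∈ allFin n ] ∑[ y ∈ allFin n ] 𝟙 (code? M x y)
      ≡⟨ ∑-cong (allFin n) (λ x → ∑-cong (allFin n) (λ y → 𝟙-× small? (free? x ×-dec free? y))) ⟩
    ∑[ x ∈ allFin n ] ∑[ y ∈ allFin n ] (𝟙 small? * 𝟙 (free? x ×-dec free? y))
      ≡⟨ ∑∑-*ˡ (𝟙 small?) (allFin n) (allFin n) (λ x y → 𝟙 (free? x ×-dec free? y)) ⟩
    𝟙 small? * ∑[ x ∈ allFin n ] ∑[ y ∈ allFin n ] 𝟙 (free? x ×-dec free? y)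
      ≡⟨ cong (𝟙 small? *_) (∑-square free?) ⟩
    𝟙 small? * (#unmatched M * #unmatched M)
      ≤⟨ 𝟙-guarded-≤ small? (λ (_ , few) → *-mono-≤ few few) ⟩
    (suc p * suc p) * 𝟙 small?
      ≤⟨ *-monoʳ-≤ (suc p * suc p) (𝟙-mono small? (inClass? M) proj₁) ⟩
    (suc p * suc p) * 𝟙 (inClass? M) ∎
    where
    open ≤-Reasoning
    small? = inClass? M ×-dec #unmatched M ≤? suc p
    free? = λ x → ¬? (matched? M x)

-- Sentence (4): matching two points

toggle : Fin 4 → Fin 4
toggle 0F = 0F
toggle 1F = 2F
toggle 2F = 1F
toggle 3F = 3F

toggleIf : Bool → Fin 4 → Fin 4
toggleIf true = toggle
toggleIf false = id

toggleIf-across : ∀ q s → toggleIf q (across s) ≡ across (q xor s)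
toggleIf-across true true = refl
toggleIf-across true false = refl
toggleIf-across false s = refl

opaque
  cloneRow : (Fin 4 → Fin 4) → Fin 4 → Fin n → Fin n → Mat n → Fin n → Fin 4
  cloneRow f v x y M = updateAt (updateAt (f ∘ M x) x (const v)) y (const 0F)

  cloneRow-self : ∀ {f v} {x y : Fin n} {M} → cloneRow f v x y M y ≡ 0F
  cloneRow-self {y = y} = updateAt-updates y _

  cloneRow-partner : ∀ {f v} {x y : Fin n} {M} → x ≢ y → cloneRow f v x y M x ≡ v
  cloneRow-partner {x = x} {y} x≢y = trans (updateAt-minimal x y _ x≢y) (updateAt-updates x _)

  cloneRow-other : ∀ {f v} {x y : Fin n} {M b} → b ≢ x → b ≢ y → cloneRow f v x y M b ≡ f (M x b)
  cloneRow-other {x = x} {y} {b = b} b≢x b≢y = trans (updateAt-minimal b y _ b≢y) (updateAt-minimal b x _ b≢x)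

cloneRow-cong : ∀ {f v} {x y : Fin n} {M N} → (∀ {b} → b ≢ y → M x b ≡ N x b) →
  ∀ b → cloneRow f v x y M b ≡ cloneRow f v x y N b
cloneRow-cong {f = f} {x = x} {y} {M} {N} Mx≗Nx b with b ≟ y | b ≟ x
... | yes refl | _ = trans (cloneRow-self {M = M}) (sym (cloneRow-self {M = N}))
... | no b≢y | yes refl = trans (cloneRow-partner {M = M} b≢y) (sym (cloneRow-partner {M = N} b≢y))
... | no b≢y | no b≢x =
  trans (cloneRow-other {M = M} b≢x b≢y)
        (trans (cong f (Mx≗Nx b≢y)) (sym (cloneRow-other {M = N} b≢x b≢y)))

clone : (Fin 4 → Fin 4) → Fin 4 → Fin n → Fin n → Mat n → Mat n
clone f v x y M = relocate y (cloneRow f v x y M) M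

clone-twice : ∀ {f v f′ v′} {x y : Fin n} {M} → x ≢ y → clone f v x y (clone f′ v′ x y M) ≋ clone f v x y M
clone-twice x≢y = ≋.trans relocate-twice (relocate-cong (cloneRow-cong (relocate-elsewhere x≢y)) ≋.refl)

clone-own : ∀ {f v} {x y : Fin n} {M} → x ≢ y → (∀ a b → M a b ≡ M b a) → M y y ≡ 0F → M y x ≡ v →
  (∀ {b} → b ≢ x → b ≢ y → M y b ≡ f (M x b)) → clone f v x y M ≋ M
clone-own {f = f} {v} {x} {y} {M} x≢y symmetric yy≡0 yx≡v yb≡ = relocate-own row-y (λ a → symmetric a y)
  where
  row-y : ∀ b → cloneRow f v x y M b ≡ M y b
  row-y b with b ≟ y | b ≟ x
  ... | yes refl | _ = trans cloneRow-self (sym yy≡0)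
  ... | no _ | yes refl = trans (cloneRow-partner x≢y) (sym yx≡v)
  ... | no b≢y | no b≢x = trans (cloneRow-other b≢x b≢y) (sym (yb≡ b≢x b≢y))

match : Fin n → Fin n → Mat n → Mat n
match = clone toggle 3F

separate : Bool → Fin n → Fin n → Mat n → Mat n
separate q = clone (toggleIf q) (across q)

module _ (B : Bipartition M side) {x y : Fin n} (x≢y : x ≢ y)
         (free-x : ¬ Matched M x) (free-y : ¬ Matched M y) where
  open Bipartition B

  private
    row = cloneRow toggle 3F x y M

    row-other : ∀ {b} → b ≢ x → b ≢ y → row b ≡ across (not (side x xor side b))
    row-other b≢x b≢y = trans (cloneRow-other b≢x b≢y)
      (trans (cong toggle (unmatched-row B free-x b≢x)) (toggleIf-across true _))

    row-3 : ∀ {b} → row b ≡ 3F → b ≡ x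
    row-3 {b} b3 with b ≟ y | b ≟ x
    ... | yes refl | _ = contradiction (trans (sym cloneRow-self) b3) λ ()
    ... | no _ | yes b≡x = b≡x
    ... | no b≢y | no b≢x = contradiction (trans (sym (row-other b≢x b≢y)) b3) (across≢3 _)

  match-bipartition : Bipartition (match x y M) (updateAt side y (const (not (side x))))
  match-bipartition = relocate-bipartition B (λ {b} b≢y → updateAt-minimal b y side b≢y) record
    { self         = cloneRow-self
    ; nonzero      = nonzero′
    ; parity       = parity′
    ; matching     = λ b3 e3 → trans (row-3 b3) (sym (row-3 e3))
    ; partner-free = λ b3 be3 → contradiction (_ , subst (λ b → M b _ ≡ 3F) (row-3 b3) be3) free-x
    }
    where
    side′ = updateAt side y (const (not (side x)))

    nonzero′ : ∀ {b} → b ≢ y → row b ≢ 0F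
    nonzero′ {b} b≢y with b ≟ x
    ... | yes refl = λ b0 → contradiction (trans (sym (cloneRow-partner x≢y)) b0) λ ()
    ... | no b≢x = across≢0 _ ∘ trans (sym (row-other b≢x b≢y))

    parity-row : ∀ {b} → b ≢ y → odd (row b) ≡ not (side x) xor side b
    parity-row {b} b≢y with b ≟ x
    ... | yes refl = trans (cong odd (cloneRow-partner x≢y))
      (trans (cong not (sym (Bool.xor-same (side x)))) (Bool.not-distribˡ-xor (side x) (side x)))
    ... | no b≢x = trans (cong odd (row-other b≢x b≢y))
      (trans (odd-across _) (Bool.not-distribˡ-xor (side x) (side b)))

    parity′ : ∀ {b} → b ≢ y → odd (row b) ≡ side′ y xor side′ b
    parity′ {b} b≢y =
      trans (parity-row b≢y) (sym (cong₂ _xor_ (updateAt-updates y side) (updateAt-minimal b y side b≢y)))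

  match-pair : match x y M x y ≡ 3F
  match-pair = trans (relocate-column x≢y) (cloneRow-partner x≢y)

  separate-match : separate (odd (M x y)) x y (match x y M) ≋ M
  separate-match = ≋.trans (clone-twice x≢y) (clone-own x≢y symmetric (diagonal y) y-x y-other)
    where
    q = odd (M x y)

    q≡ : q ≡ side x xor side y
    q≡ = parity x≢y

    y-x : M y x ≡ across q
    y-x = trans (unmatched-row B free-y x≢y) (cong across (trans (Bool.xor-comm (side y) (side x)) (sym q≡)))

    y-other : ∀ {b} → b ≢ x → b ≢ y → M y b ≡ toggleIf q (M x b)
    y-other {b} b≢x b≢y = begin
      M y b                                    ≡⟨ unmatched-row B free-y b≢y ⟩
      across (side y xor side b)               ≡⟨ cong across (xor-cancelˡ (side x) (side y) (side b)) ⟨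
      across ((side x xor side y) xor (side x xor side b))
                                               ≡⟨ cong (λ s → across (s xor (side x xor side b))) q≡ ⟨
      across (q xor (side x xor side b))       ≡⟨ toggleIf-across q _ ⟨
      toggleIf q (across (side x xor side b))  ≡⟨ cong (toggleIf q) (unmatched-row B free-x b≢x) ⟨
      toggleIf q (M x b)                       ∎
      where open ≡-Reasoning

linear-gap : ∀ {k p n u} → 2 * p + 4 * k ≤ n → n < u + p → p + 4 * k < u
linear-gap {k} {p} {n} {u} n≥ n<u+p = +-cancelˡ-< p (p + 4 * k) u (begin-strict
  p + (p + 4 * k)  ≡⟨ split-2p p k ⟨
  2 * p + 4 * k    ≤⟨ n≥ ⟩
  n                <⟨ n<u+p ⟩
  u + p            ≡⟨ +-comm u p ⟩
  p + u            ∎)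
  where
  open ≤-Reasoning
  split-2p : ∀ p k → 2 * p + 4 * k ≡ p + (p + 4 * k)
  split-2p = solve-∀

quadratic-beats-linear : ∀ {k p n u w} → 2 * p + 4 * k ≤ n → n < u + p → u * u ≤ w + u → k * (2 * n) ≤ w
quadratic-beats-linear {k} {p} {n} {zero} n≥ n<u+p _ = contradiction (linear-gap {k} {p} {n} {0} n≥ n<u+p) λ ()
quadratic-beats-linear {k} {p} {n} {suc v} {w} n≥ n<u+p u²≤w+u = begin
  k * (2 * n)        ≤⟨ *-monoʳ-≤ k (*-monoʳ-≤ 2 n≤2u) ⟩
  k * (2 * (2 * u))  ≡⟨ rearrange k u ⟩
  4 * k * u          ≤⟨ *-monoˡ-≤ u (≤-pred (≤-trans (s≤s (m≤n+m (4 * k) p)) gap)) ⟩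
  v * u              ≤⟨ +-cancelˡ-≤ u (v * u) w (≤-trans u²≤w+u (≤-reflexive (+-comm w u))) ⟩
  w                  ∎
  where
  open ≤-Reasoning
  u = suc v
  gap = linear-gap {k} {p} {n} {u} n≥ n<u+p
  rearrange : ∀ k u → k * (2 * (2 * u)) ≡ 4 * k * u
  rearrange = solve-∀
  n≤2u : n ≤ 2 * u
  n≤2u = begin
    n          ≤⟨ <⇒≤ n<u+p ⟩
    u + p      ≤⟨ +-monoʳ-≤ u (≤-trans (m≤m+n p (4 * k)) (<⇒≤ gap)) ⟩
    u + u      ≡⟨ cong (u +_) (+-identityʳ u) ⟨
    2 * u      ∎

φ4-rare : ∀ p k n → 1 ≤ k → 2 * p + 4 * k ≤ n → k * #bad (φ4 {p}) n ≤ total n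
φ4-rare p k zero k≥1 n≥ = contradiction (≤-trans (≤-trans (*-monoʳ-≤ 4 k≥1) (m≤n+m (4 * k) (2 * p))) n≥) λ ()
φ4-rare p k n@(suc _) _ n≥ = subst (k * #bad (φ4 {p}) n ≤_) (sym (total≡∑ n))
  (rarity k (2 * n) inClass? many-moves few-codes)
  where
  pairs = cartesianProduct (allFin n) (allFin n)
  bools = true ∷ false ∷ []

  Move : Mat n → Fin n × Fin n → Set
  Move M (x , y) = ¬ Matched M x × ¬ Matched M y × x ≢ y

  move? : ∀ M π → Dec (Move M π)
  move? M (x , y) = ¬? (matched? M x) ×-dec ¬? (matched? M y) ×-dec ¬? (x ≟ y)

  Code : Mat n → Fin n × Fin n → Bool → Set
  Code M (x , y) _ = InClass M × M x y ≡ 3F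

  code? : ∀ M π q → Dec (Code M π q)
  code? M (x , y) _ = inClass? M ×-dec M x y ≟ 3F

  code-resp : ∀ {M N π q} → M ≋ N → Code M π q → Code N π q
  code-resp {π = x , y} M≋N (C , xy3) = InClass-resp M≋N C , trans (sym (M≋N x y)) xy3

  decodable : ∀ {M π} → Bad (φ4 {p}) M → Move M π →
    ∃[ q ] q ∈ bools × Code (match (proj₁ π) (proj₂ π) M) π q
         × separate q (proj₁ π) (proj₂ π) (match (proj₁ π) (proj₂ π) M) ≋ M
  decodable {M} {x , y} (C , _) (free-x , free-y , x≢y) =
    odd (M x y) , bool∈ (odd (M x y))
    , (bipartition⇒inClass (match-bipartition parts x≢y free-x free-y) , match-pair parts x≢y free-x free-y)
    , separate-match parts x≢y free-x free-y
    where
    parts = inClass⇒bipartition C x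
    bool∈ : ∀ q → q ∈ bools
    bool∈ true = here refl
    bool∈ false = there (here refl)

  open DoubleCounting ≋-isEquivalence _≋?_ (allMats n) allMats-once (bad? (φ4 {p})) pairs move?
    bools code? (λ (x , y) → match x y) (λ (x , y) q → separate q x y)
    (λ {q = q} → code-resp {q = q})
    (λ {π = π} M≋N → relocate-cong (cloneRow-cong (λ {b} _ → M≋N (proj₁ π) b)) M≋N) decodable

  many-moves : ∀ {M} → Bad (φ4 {p}) M → k * (2 * n) ≤ ∑[ π ∈ pairs ] 𝟙 (move? M π)
  many-moves {M} bad = quadratic-beats-linear {k} {p} {n} {#unmatched M} n≥ n<u+p
    (subst (λ m → #unmatched M * #unmatched M ≤ m + #unmatched M)
      (sym (∑-cartesianProduct (allFin n) (allFin n) (𝟙 ∘ move? M)))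
      (∑-distinct-pairs (¬? ∘ matched? M)))
    where
    n<u+p : n < #unmatched M + p
    n<u+p = begin-strict
      n                          ≡⟨ #matched+#unmatched M ⟨
      #matched M + #unmatched M  <⟨ +-monoˡ-< (#unmatched M) (few-matched bad) ⟩
      p + #unmatched M           ≡⟨ +-comm p (#unmatched M) ⟩
      #unmatched M + p           ∎
      where open ≤-Reasoning

  few-codes : ∀ M → ∑[ π ∈ pairs ] ∑[ q ∈ bools ] 𝟙 (code? M π q) ≤ (2 * n) * 𝟙 (inClass? M)
  few-codes M = begin
    ∑[ π ∈ pairs ] (2 * 𝟙 (code? M π true))
      ≡⟨ ∑-*ˡ 2 pairs (λ π → 𝟙 (code? M π true)) ⟩
    2 * ∑[ π ∈ pairs ] 𝟙 (code? M π true)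
      ≡⟨ cong (2 *_) (∑-cartesianProduct (allFin n) (allFin n) (λ π → 𝟙 (code? M π true))) ⟩
    2 * ∑[ x ∈ allFin n ] ∑[ y ∈ allFin n ] 𝟙 (inClass? M ×-dec M x y ≟ 3F)
      ≡⟨ cong (2 *_) (∑-cong (allFin n) (λ x → ∑-cong (allFin n) (λ y → 𝟙-× (inClass? M) (M x y ≟ 3F)))) ⟩
    2 * ∑[ x ∈ allFin n ] ∑[ y ∈ allFin n ] (𝟙 (inClass? M) * 𝟙 (M x y ≟ 3F))
      ≡⟨ cong (2 *_) (∑∑-*ˡ (𝟙 (inClass? M)) (allFin n) (allFin n) (λ x y → 𝟙 (M x y ≟ 3F))) ⟩
    2 * (𝟙 (inClass? M) * ∑[ x ∈ allFin n ] ∑[ y ∈ allFin n ] 𝟙 (M x y ≟ 3F))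
      ≤⟨ *-monoʳ-≤ 2 (𝟙-guarded-≤ (inClass? M) λ C → ≤-trans
           (∑-mono-≤ (allFin n) (λ x → ∑-allFin-≤1 (λ y → M x y ≟ 3F) (inClass-matching C)))
           (≤-reflexive (∑-allFin-1 n))) ⟩
    2 * (n * 𝟙 (inClass? M))
      ≡⟨ *-assoc 2 n _ ⟨
    2 * n * 𝟙 (inClass? M) ∎
    where open ≤-Reasoning

eventually-rare : ∀ {p} (φ : Sentence p) k → 1 ≤ k → ∃ λ N → ∀ n → n ≥ N → k * #bad φ n ≤ total n
eventually-rare {p} φ1 k _ = 0 , λ n _ → never-bad (φ1 {p}) (inClass⇒φ1 {p = p}) k n
eventually-rare {p} φ2 k _ = 0 , λ n _ → never-bad (φ2 {p}) (inClass⇒φ2 {p = p}) k n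
eventually-rare {p} φ3 k _ = 0 , λ n _ → never-bad (φ3 {p}) (inClass⇒φ3 {p = p}) k n
eventually-rare {p} φ4 k k≥1 = 2 * p + 4 * k , λ n → φ4-rare p k n k≥1
eventually-rare {p} φ5 k _ = k * (suc p * suc p) + p , λ n → φ5-rare p k n

lemma4p5 : (p : ℕ) (φ : Sentence p) (k : ℕ) → 1 ≤ k →
    ∃ λ N → ∀ n → n ≥ N → k * (total n ∸ good φ n) ≤ total n
lemma4p5 p φ k k≥1 =
  let N , rare = eventually-rare φ k k≥1
  in N , λ n n≥N → subst (λ b → k * b ≤ total n) (sym (total∸good≡#bad φ n)) (rare n n≥N)
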